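{- Let $G$ be a regular graph, let $\alpha_0$ be a proper $t_0$-edge-coloring of $G$, and let $D\subseteq V(G)$ be a set of vertices with $S(D,\alpha_0)\neq\emptyset$. If $def(v,\alpha_0)=0$ for every $v\in V(G)\setminus D$, then for every integer $t$ with $\max S(D,\alpha_0)-\min S(D,\alpha_0)+1\leq t\leq t_0$, the graph $G$ has a proper $t$-edge-coloring $\alpha$ such that $def(v,\alpha)=def(v,\alpha_0)$ for every vertex $v\in V(G)$.
   Context: All graphs are finite, undirected, without loops or multiple edges. A proper $t$-edge-coloring of $G$ is a map $\alpha:E(G)\to\{1,\ldots,t\}$ such that all $t$ colors are used and adjacent edges receive different colors. The spectrum $S(v,\alpha)$ of a vertex $v$ is the set of colors on edges incident to $v$, and for $D\subseteq V(G)$, $S(D,\alpha)=\bigcup_{v\in D}S(v,\alpha)$. For a finite set $A$ of integers, $def(A)=\max A-\min A-|A|+1$ ($def(\emptyset)=0$), and $def(v,\alpha)=def(S(v,\alpha))$. -}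

module Defs where

open import Data.Bool using (Bool; true; false; T)
open import Data.Nat using (ℕ; zero; suc; _∸_; _≤_; _⊔_; _⊓_)
open import Data.Nat.Properties using (_≟_)
open import Data.Fin using (Fin)
open import Data.List using (List; []; _∷_; map; filter; foldr; length; concatMap; deduplicate; allFin)
open import Data.Product using (Σ; ∃; _×_; _,_)
open import Relation.Nullary using (¬_)
open import Relation.Binary.PropositionalEquality using (_≡_)
open import Relation.Nullary.Decidable using (T?)

record Graph : Set where
  field
    n     : ℕ
    adj   : Fin n → Fin n → Bool
    sym   : ∀ u v → adj u v ≡ adj v u
    irrefl : ∀ v → adj v v ≡ false
open Graph public

Vertex : Graph → Set
Vertex G = Fin (n G)

Adj : (G : Graph) → Vertex G → Vertex G → Set
Adj G u v = T (adj G u v)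

neighbours : (G : Graph) → Vertex G → List (Vertex G)
neighbours G v = filter (λ u → T? (adj G v u)) (allFin (n G))

degree : (G : Graph) → Vertex G → ℕ
degree G v = length (neighbours G v)

Regular : Graph → Set
Regular G = ∃ λ r → ∀ v → degree G v ≡ r

-- An edge map: colour of edge uv is α u v (only values on edges matter).
EdgeMap : Graph → Set
EdgeMap G = Vertex G → Vertex G → ℕ

record ProperEdgeColoring (G : Graph) (t : ℕ) (α : EdgeMap G) : Set where
  field
    symm    : ∀ u v → Adj G u v → α u v ≡ α v u
    range   : ∀ u v → Adj G u v → 1 ≤ α u v × α u v ≤ t
    proper  : ∀ u v w → Adj G u v → Adj G u w → ¬ (v ≡ w) → ¬ (α u v ≡ α u w)
    surj    : ∀ k → 1 ≤ k → k ≤ t → Σ (Vertex G) λ u → Σ (Vertex G) λ v → Adj G u v × α u v ≡ k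

-- Spectrum of a vertex (as a list of colours; as a set, duplicates are irrelevant).
spectrum : (G : Graph) → EdgeMap G → Vertex G → List ℕ
spectrum G α v = map (α v) (neighbours G v)

spectrumSet : (G : Graph) → EdgeMap G → (Vertex G → Bool) → List ℕ
spectrumSet G α D = concatMap (spectrum G α) (filter (λ v → T? (D v)) (allFin (n G)))

maxL : List ℕ → ℕ
maxL [] = 0
maxL (x ∷ xs) = foldr _⊔_ x xs

minL : List ℕ → ℕ
minL [] = 0
minL (x ∷ xs) = foldr _⊓_ x xs

card : List ℕ → ℕ
card xs = length (deduplicate _≟_ xs)

defect : List ℕ → ℕ
defect [] = 0
defect xs@(_ ∷ _) = (suc (maxL xs) ∸ minL xs) ∸ card xs

defV : (G : Graph) → EdgeMap G → Vertex G → ℕ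
defV G α v = defect (spectrum G α v)

-- Regularity gives every spectrum exactly r = deg colours, so a vertex outside D (defect 0)
-- sees r consecutive colours, and pigeonhole at a vertex of D gives r ≤ t.  Keep the window
-- [s + 1, s + t] of t colours containing every colour used at D, reduce colours below it
-- modulo r into its lowest r places and colours above it into its highest r places, and
-- shift down by s.  On any r consecutive colours this map agrees with reduction modulo r into
-- a single block of r colours, so it is injective there and its image is again r consecutive
-- colours: properness and the zero defects outside D survive, spectra at D are only
-- translated, and every colour s + 1, …, s + t is still used.
module Submission where

open import Defs hiding (sym)
open import Data.Bool using (Bool; true; false; T)
open import Data.Empty using (⊥-elim)
open import Data.Unit using (tt)
open import Function using (_∘_)
open import Relation.Nullary.Decidable using (T?)
open import Data.List using (List; []; _∷_; map; filter; length; deduplicate; allFin)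
open import Data.List.Membership.Propositional using (_∈_; find; lose)
open import Data.List.Membership.Propositional.Properties using (foldr-selective; ∈-length; ∈-allFin; ∈-filter⁺; ∈-filter⁻; ∈-map⁺; ∈-map⁻; ∈-concatMap⁺; ∈-concatMap⁻)
open import Data.List.Properties using (filter-all; filter-accept; filter-reject; foldr-preservesᵇ; foldr-preservesᵒ; length-map; map-∘; map-cong-local)
open import Data.List.Relation.Unary.All as All using (All; []; _∷_)
import Data.List.Relation.Unary.All.Properties as AllP
open import Data.List.Relation.Unary.Any as Any using (here; there)
open import Data.List.Relation.Unary.Unique.Propositional using (Unique; []; _∷_)
import Data.List.Relation.Unary.Unique.Propositional.Properties as Unique
open import Data.Nat using (ℕ; zero; suc; _+_; _*_; _∸_; _≤_; _<_; _⊔_; _⊓_; z≤n; s≤s; s≤s⁻¹; _≤?_; NonZero; >-nonZero)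
open import Data.Nat.DivMod using (_%_; _/_; m≡m%n+[m/n]*n; m%n<n; [m+kn]%n≡m%n; m<n⇒m%n≡m)
open import Data.Nat.Properties
open import Data.Nat.Tactic.RingSolver using (solve-∀)
open import Data.Product using (Σ; ∃; _×_; _,_; proj₁; proj₂)
open import Data.Sum using (_⊎_; inj₁; inj₂; [_,_])
open import Relation.Nullary using (¬_; yes; no; ¬?; contradiction)
open import Relation.Binary.PropositionalEquality hiding ([_])

InWindow : ℕ → ℕ → ℕ → Set
InWindow n x c = x ≤ c × c < x + n

maxL-≤ : ∀ {xs y} → y ∈ xs → y ≤ maxL xs
maxL-≤ {x ∷ xs} y∈ = foldr-preservesᵒ
  (λ a b → [ m≤n⇒m≤n⊔o b , m≤n⇒m≤o⊔n a ]) x xs (toAny y∈)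
  where
  toAny : ∀ {y} → y ∈ x ∷ xs → y ≤ x ⊎ Any.Any (y ≤_) xs
  toAny (here refl) = inj₁ ≤-refl
  toAny (there y∈) = inj₂ (Any.map ≤-reflexive y∈)

minL-≤ : ∀ {xs y} → y ∈ xs → minL xs ≤ y
minL-≤ {x ∷ xs} y∈ = foldr-preservesᵒ
  (λ a b → [ m≤n⇒m⊓o≤n b , m≤n⇒o⊓m≤n a ]) x xs (toAny y∈)
  where
  toAny : ∀ {y} → y ∈ x ∷ xs → x ≤ y ⊎ Any.Any (_≤ y) xs
  toAny (here refl) = inj₁ ≤-refl
  toAny (there y∈) = inj₂ (Any.map (λ y≡z → ≤-reflexive (sym y≡z)) y∈)

maxL-least : ∀ {xs k} → All (_≤ k) xs → maxL xs ≤ k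
maxL-least [] = z≤n
maxL-least (x≤k ∷ xs≤k) = foldr-preservesᵇ ⊔-lub x≤k xs≤k

minL-greatest : ∀ {x xs k} → All (k ≤_) (x ∷ xs) → k ≤ minL (x ∷ xs)
minL-greatest (k≤x ∷ k≤xs) = foldr-preservesᵇ ⊓-glb k≤x k≤xs

maxL-∈ : ∀ x xs → maxL (x ∷ xs) ∈ x ∷ xs
maxL-∈ x xs with foldr-selective ⊔-sel x xs
... | inj₁ max≡x = here max≡x
... | inj₂ max∈xs = there max∈xs

maxL-map-∸ : ∀ s x xs → maxL (map (_∸ s) (x ∷ xs)) ≡ maxL (x ∷ xs) ∸ s
maxL-map-∸ s x [] = refl
maxL-map-∸ s x (y ∷ ys) = trans (cong ((y ∸ s) ⊔_) (maxL-map-∸ s x ys)) (sym (∸-distribʳ-⊔ s y _))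

minL-map-∸ : ∀ s x xs → minL (map (_∸ s) (x ∷ xs)) ≡ minL (x ∷ xs) ∸ s
minL-map-∸ s x [] = refl
minL-map-∸ s x (y ∷ ys) = trans (cong ((y ∸ s) ⊓_) (minL-map-∸ s x ys)) (sym (∸-distribʳ-⊓ s y _))

suc[m∸o]∸[n∸o]≡suc[m]∸n : ∀ {m n o} → o ≤ m → o ≤ n → suc (m ∸ o) ∸ (n ∸ o) ≡ suc m ∸ n
suc[m∸o]∸[n∸o]≡suc[m]∸n {m} {n} {o} o≤m o≤n = begin
  suc (m ∸ o) ∸ (n ∸ o)  ≡⟨ cong (_∸ (n ∸ o)) (+-∸-assoc 1 o≤m) ⟨
  suc m ∸ o ∸ (n ∸ o)    ≡⟨ ∸-+-assoc (suc m) o (n ∸ o) ⟩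
  suc m ∸ (o + (n ∸ o))  ≡⟨ cong (suc m ∸_) (m+[n∸m]≡n o≤n) ⟩
  suc m ∸ n              ∎
  where open ≡-Reasoning

Unique-map⁺ : ∀ {A B : Set} (f : A → B) {xs} →
  (∀ {x y} → x ∈ xs → y ∈ xs → ¬ x ≡ y → ¬ f x ≡ f y) → Unique xs → Unique (map f xs)
Unique-map⁺ f pres [] = []
Unique-map⁺ f pres (x∉xs ∷ u) =
  AllP.map⁺ (All.tabulate (λ y∈ → pres (here refl) (there y∈) (All.lookup x∉xs y∈)))
  ∷ Unique-map⁺ f (λ x∈ y∈ → pres (there x∈) (there y∈)) u

deduplicate-Unique : ∀ {xs} → Unique xs → deduplicate _≟_ xs ≡ xs
deduplicate-Unique [] = refl
deduplicate-Unique {x ∷ xs} (x∉xs ∷ u) rewrite deduplicate-Unique u =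
  cong (x ∷_) (filter-all (λ y → ¬? (x ≟ y)) x∉xs)

card-Unique : ∀ {xs} → Unique xs → card xs ≡ length xs
card-Unique u = cong length (deduplicate-Unique u)

length≤suc[length-filter-≢] : ∀ c {xs} → Unique xs → length xs ≤ suc (length (filter (λ y → ¬? (y ≟ c)) xs))
length≤suc[length-filter-≢] c [] = z≤n
length≤suc[length-filter-≢] c {x ∷ xs} (x∉xs ∷ u) with x ≟ c
... | yes refl rewrite filter-reject (λ y → ¬? (y ≟ c)) {xs = xs} (λ c≢c → c≢c refl)
                     | filter-all (λ y → ¬? (y ≟ c)) (All.map (λ c≢y y≡c → c≢y (sym y≡c)) x∉xs) = ≤-refl
... | no x≢c rewrite filter-accept (λ y → ¬? (y ≟ c)) {xs = xs} x≢c = s≤s (length≤suc[length-filter-≢] c u)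

Unique∧InWindow⇒length≤ : ∀ n a {xs} → Unique xs → All (InWindow n a) xs → length xs ≤ n
Unique∧InWindow⇒length≤ zero a [] _ = z≤n
Unique∧InWindow⇒length≤ zero a (_ ∷ _) ((a≤x , x<a+0) ∷ _) = ⊥-elim (<⇒≱ (subst (_ <_) (+-identityʳ a) x<a+0) a≤x)
Unique∧InWindow⇒length≤ (suc n) a {xs} u inW = ≤-trans (length≤suc[length-filter-≢] (a + n) u)
  (s≤s (Unique∧InWindow⇒length≤ n a (Unique.filter⁺ ≢top? u)
    (All.zipWith shrink (AllP.filter⁺ ≢top? inW , AllP.all-filter ≢top? xs))))
  where
  ≢top? = λ y → ¬? (y ≟ a + n)
  shrink : ∀ {y} → InWindow (suc n) a y × ¬ y ≡ a + n → InWindow n a y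
  shrink {y} ((a≤y , y<) , y≢top) = a≤y , ≤∧≢⇒< (s≤s⁻¹ (subst (y <_) (+-suc a n) y<)) y≢top

defect≡0⇒InWindow : ∀ {xs} → Unique xs → defect xs ≡ 0 → All (InWindow (length xs) (minL xs)) xs
defect≡0⇒InWindow {[]} _ _ = []
defect≡0⇒InWindow {xs@(_ ∷ _)} u defect≡0 = All.tabulate λ {c} c∈ → minL-≤ c∈ , (begin-strict
  c                                ≤⟨ maxL-≤ c∈ ⟩
  maxL xs                          <⟨ m≤n+m∸n (suc (maxL xs)) (minL xs) ⟩
  minL xs + (suc (maxL xs) ∸ minL xs) ≤⟨ +-monoʳ-≤ (minL xs) span≤length ⟩
  minL xs + length xs              ∎)
  where
  open ≤-Reasoning
  span≤length : suc (maxL xs) ∸ minL xs ≤ length xs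
  span≤length = subst (suc (maxL xs) ∸ minL xs ≤_) (card-Unique u) (m∸n≡0⇒m≤n defect≡0)

InWindow⇒defect≡0 : ∀ {xs y} → Unique xs → All (InWindow (length xs) y) xs → defect xs ≡ 0
InWindow⇒defect≡0 {[]} _ _ = refl
InWindow⇒defect≡0 {xs@(x ∷ xs′)} {y} u inW = m≤n⇒m∸n≡0 (begin
  suc (maxL xs) ∸ minL xs ≤⟨ ∸-monoʳ-≤ (suc (maxL xs)) (minL-greatest (All.map proj₁ inW)) ⟩
  suc (maxL xs) ∸ y       ≤⟨ m≤n+o⇒m∸n≤o (suc (maxL xs)) y (proj₂ (All.lookup inW (maxL-∈ x xs′))) ⟩
  length xs               ≡⟨ card-Unique u ⟨
  card xs                 ∎)
  where open ≤-Reasoning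

defect-map-∸ : ∀ s {xs} → Unique xs → All (s ≤_) xs → defect (map (_∸ s) xs) ≡ defect xs
defect-map-∸ s {[]} _ _ = refl
defect-map-∸ s {xs@(x ∷ xs′)} u s≤xs = begin
  suc (maxL (map (_∸ s) xs)) ∸ minL (map (_∸ s) xs) ∸ card (map (_∸ s) xs)
    ≡⟨ cong₂ (λ M m → suc M ∸ m ∸ card (map (_∸ s) xs)) (maxL-map-∸ s x xs′) (minL-map-∸ s x xs′) ⟩
  suc (maxL xs ∸ s) ∸ (minL xs ∸ s) ∸ card (map (_∸ s) xs)
    ≡⟨ cong₂ _∸_ (suc[m∸o]∸[n∸o]≡suc[m]∸n s≤max s≤min) (trans (card-Unique u′) (length-map (_∸ s) xs)) ⟩
  suc (maxL xs) ∸ minL xs ∸ length xs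
    ≡⟨ cong (suc (maxL xs) ∸ minL xs ∸_) (card-Unique u) ⟨
  defect xs ∎
  where
  open ≡-Reasoning
  s≤min = minL-greatest s≤xs
  s≤max = ≤-trans (All.lookup s≤xs (here refl)) (maxL-≤ {xs} (here refl))
  u′ = Unique-map⁺ (_∸ s) (λ c∈ c′∈ c≢c′ → c≢c′ ∘ ∸-cancelʳ-≡ (All.lookup s≤xs c∈) (All.lookup s≤xs c′∈)) u

InWindow-+ʳ : ∀ {n a b} k → InWindow n a b → InWindow n (a + k) (b + k)
InWindow-+ʳ {n} {a} {b} k (a≤b , b<a+n) =
  +-monoˡ-≤ k a≤b , subst (b + k <_) (+-right-comm a n k) (+-monoˡ-< k b<a+n)
  where
  +-right-comm : ∀ x y z → x + y + z ≡ x + z + y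
  +-right-comm = solve-∀

%-injective-InWindow : ∀ n .{{_ : NonZero n}} {a b} → InWindow n a b → a % n ≡ b % n → a ≡ b
%-injective-InWindow n {a} {b} (a≤b , b<a+n) a%n≡b%n = begin
  a            ≡⟨ a≡ρ+qn ⟩
  ρ + q * n    ≡⟨ cong (λ k → ρ + k * n) (≤-antisym q≤q′ (s≤s⁻¹ q′<1+q)) ⟩
  ρ + q′ * n   ≡⟨ m≡m%n+[m/n]*n b n ⟨
  b            ∎
  where
  open ≡-Reasoning
  ρ = b % n
  q = a / n
  q′ = b / n
  a≡ρ+qn : a ≡ ρ + q * n
  a≡ρ+qn = trans (m≡m%n+[m/n]*n a n) (cong (_+ q * n) a%n≡b%n)
  q≤q′ : q ≤ q′
  q≤q′ = *-cancelʳ-≤ q q′ n (+-cancelˡ-≤ ρ _ _ (subst₂ _≤_ a≡ρ+qn (m≡m%n+[m/n]*n b n) a≤b))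
  a+n≡ρ+[1+q]n : a + n ≡ ρ + suc q * n
  a+n≡ρ+[1+q]n = trans (cong (_+ n) a≡ρ+qn) (trans (+-assoc ρ (q * n) n) (cong (ρ +_) (+-comm (q * n) n)))
  q′<1+q : q′ < suc q
  q′<1+q = *-cancelʳ-< n q′ (suc q)
    (+-cancelˡ-< ρ _ _ (subst₂ _<_ (m≡m%n+[m/n]*n b n) a+n≡ρ+[1+q]n b<a+n))

module Wrap (p : ℕ) where

  r : ℕ
  r = suc p

  -- The representative of c modulo r in [L, L + r): adding p * L ≡ -L (mod r) avoids subtraction.
  wrap : ℕ → ℕ → ℕ
  wrap L c = L + (c + p * L) % r

  wrap-InWindow : ∀ L c → InWindow r L (wrap L c)
  wrap-InWindow L c = m≤m+n L _ , +-monoʳ-< L (m%n<n (c + p * L) r)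

  wrap-id : ∀ {L c} → InWindow r L c → wrap L c ≡ c
  wrap-id {L} (L≤c , c<L+r) with m≤n⇒∃[o]m+o≡n L≤c
  ... | d , refl = cong (L +_) (begin
    (L + d + p * L) % r  ≡⟨ cong (_% r) (L+d+pL≡d+Lr p L d) ⟩
    (d + L * r) % r      ≡⟨ [m+kn]%n≡m%n d L r ⟩
    d % r                ≡⟨ m<n⇒m%n≡m (+-cancelˡ-< L d r c<L+r) ⟩
    d                    ∎)
    where
    open ≡-Reasoning
    L+d+pL≡d+Lr : ∀ q L d → L + d + q * L ≡ d + L * suc q
    L+d+pL≡d+Lr = solve-∀

  wrap-injective-InWindow : ∀ L {c c′} → InWindow r c c′ → wrap L c ≡ wrap L c′ → c ≡ c′
  wrap-injective-InWindow L {c} {c′} near wc≡wc′ = +-cancelʳ-≡ (p * L) c c′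
    (%-injective-InWindow r (InWindow-+ʳ (p * L) near) (+-cancelˡ-≡ L _ _ wc≡wc′))

  wrap-injective : ∀ L {x c c′} → InWindow r x c → InWindow r x c′ → wrap L c ≡ wrap L c′ → c ≡ c′
  wrap-injective L (x≤c , c<x+r) (x≤c′ , c′<x+r) wc≡wc′ with ≤-total _ _
  ... | inj₁ c≤c′ = wrap-injective-InWindow L (c≤c′ , <-≤-trans c′<x+r (+-monoˡ-≤ r x≤c)) wc≡wc′
  ... | inj₂ c′≤c = sym (wrap-injective-InWindow L (c′≤c , <-≤-trans c<x+r (+-monoˡ-≤ r x≤c′)) (sym wc≡wc′))

module Recolour (p s t : ℕ) (r≤t : suc p ≤ t) where
  open Wrap p public

  -- Start of the highest window of length r inside [s + 1, s + t].
  top : ℕ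
  top = suc (s + (t ∸ r))

  top+r≡1+s+t : top + r ≡ suc (s + t)
  top+r≡1+s+t = cong suc (trans (+-assoc s (t ∸ r) r) (cong (s +_) (m∸n+n≡m r≤t)))

  recolour : ℕ → ℕ
  recolour c with c ≤? s | c ≤? s + t
  ... | yes _ | _     = wrap (suc s) c
  ... | no _  | yes _ = c
  ... | no _  | no _  = wrap top c

  recolour-below : ∀ {c} → c ≤ s → recolour c ≡ wrap (suc s) c
  recolour-below {c} c≤s with c ≤? s | c ≤? s + t
  ... | yes _   | _ = refl
  ... | no c≰s  | _ = contradiction c≤s c≰s

  recolour-middle : ∀ {c} → InWindow t (suc s) c → recolour c ≡ c
  recolour-middle {c} (s<c , c<1+s+t) with c ≤? s | c ≤? s + t
  ... | yes c≤s | _     = contradiction c≤s (<⇒≱ s<c)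
  ... | no _    | yes _ = refl
  ... | no _    | no c≰s+t = contradiction (s≤s⁻¹ c<1+s+t) c≰s+t

  recolour-above : ∀ {c} → s + t < c → recolour c ≡ wrap top c
  recolour-above {c} s+t<c with c ≤? s | c ≤? s + t
  ... | yes c≤s | _ = contradiction (≤-trans c≤s (m≤m+n s t)) (<⇒≱ s+t<c)
  ... | no _ | yes c≤s+t = contradiction c≤s+t (<⇒≱ s+t<c)
  ... | no _ | no _ = refl

  1+s≤top : suc s ≤ top
  1+s≤top = s≤s (m≤m+n s _)

  recolour-InWindow : ∀ c → InWindow t (suc s) (recolour c)
  recolour-InWindow c with c ≤? s | c ≤? s + t
  ... | yes _ | _ = let (lo , hi) = wrap-InWindow (suc s) c in lo , <-≤-trans hi (+-monoʳ-≤ (suc s) r≤t)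
  ... | no c≰s | yes c≤s+t = ≰⇒> c≰s , s≤s c≤s+t
  ... | no _ | no _ = let (lo , hi) = wrap-InWindow top c in ≤-trans 1+s≤top lo , subst (wrap top c <_) top+r≡1+s+t hi

  recolour-window : ∀ x → Σ ℕ λ L → suc s ≤ L × (∀ {c} → InWindow r x c → recolour c ≡ wrap L c)
  recolour-window x with x ≤? s
  ... | yes x≤s = suc s , ≤-refl , bottom
    where
    bottom : ∀ {c} → InWindow r x c → recolour c ≡ wrap (suc s) c
    bottom {c} (_ , c<x+r) with ≤-<-connex c s
    ... | inj₁ c≤s = recolour-below c≤s
    ... | inj₂ s<c = trans (recolour-middle (s<c , <-≤-trans c<1+s+r (+-monoʳ-≤ (suc s) r≤t)))
                           (sym (wrap-id (s<c , c<1+s+r)))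
      where
      c<1+s+r : c < suc s + r
      c<1+s+r = <-≤-trans c<x+r (≤-trans (+-monoˡ-≤ r x≤s) (n≤1+n _))
  ... | no x≰s with x + r ≤? suc (s + t)
  ... | yes x+r≤1+s+t = x , ≰⇒> x≰s , λ c∈ →
        trans (recolour-middle (≤-trans (≰⇒> x≰s) (proj₁ c∈) , <-≤-trans (proj₂ c∈) x+r≤1+s+t)) (sym (wrap-id c∈))
  ... | no x+r≰1+s+t = top , 1+s≤top , highest
    where
    top≤x : top ≤ x
    top≤x = +-cancelʳ-≤ r top x (subst (_≤ x + r) (sym top+r≡1+s+t) (<⇒≤ (≰⇒> x+r≰1+s+t)))
    highest : ∀ {c} → InWindow r x c → recolour c ≡ wrap top c
    highest {c} (x≤c , _) with ≤-<-connex c (s + t)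
    ... | inj₁ c≤s+t = trans (recolour-middle (≤-trans (≰⇒> x≰s) x≤c , s≤s c≤s+t))
                            (sym (wrap-id (≤-trans top≤x x≤c , subst (c <_) (sym top+r≡1+s+t) (s≤s c≤s+t))))
    ... | inj₂ s+t<c = recolour-above s+t<c

InWindow-∸ : ∀ {n x y} s → s ≤ x → InWindow n x y → InWindow n (x ∸ s) (y ∸ s)
InWindow-∸ {n} {x} {y} s s≤x (x≤y , y<x+n) =
  ∸-monoˡ-≤ s x≤y , subst (y ∸ s <_) (+-∸-comm n s≤x) (∸-monoˡ-< y<x+n (≤-trans s≤x x≤y))

≢[]⇒∃∈ : ∀ {A : Set} {xs : List A} → ¬ xs ≡ [] → ∃ λ x → x ∈ xs
≢[]⇒∃∈ {xs = []} xs≢[] = contradiction refl xs≢[]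
≢[]⇒∃∈ {xs = x ∷ _} _ = x , here refl

T-or-false : ∀ b → T b ⊎ b ≡ false
T-or-false true = inj₁ tt
T-or-false false = inj₂ refl

module Spectra (G : Graph) where

  ∈-neighbours⁺ : ∀ {u v} → Adj G u v → v ∈ neighbours G u
  ∈-neighbours⁺ {u} {v} uv = ∈-filter⁺ (λ w → T? (adj G u w)) (∈-allFin v) uv

  ∈-neighbours⁻ : ∀ {u v} → v ∈ neighbours G u → Adj G u v
  ∈-neighbours⁻ {u} v∈ = proj₂ (∈-filter⁻ (λ w → T? (adj G u w)) {xs = allFin (n G)} v∈)

  ∈-spectrum⁺ : ∀ (α : EdgeMap G) {u v} → Adj G u v → α u v ∈ spectrum G α u
  ∈-spectrum⁺ α uv = ∈-map⁺ (α _) (∈-neighbours⁺ uv)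

  ∈-spectrum⁻ : ∀ (α : EdgeMap G) {u c} → c ∈ spectrum G α u → ∃ λ v → Adj G u v × c ≡ α u v
  ∈-spectrum⁻ α {u} c∈ with ∈-map⁻ (α u) c∈
  ... | v , v∈ , c≡αuv = v , ∈-neighbours⁻ v∈ , c≡αuv

  Unique-spectrum : ∀ {t α} → ProperEdgeColoring G t α → ∀ u → Unique (spectrum G α u)
  Unique-spectrum {α = α} proper u = Unique-map⁺ (α u)
    (λ v∈ w∈ → ProperEdgeColoring.proper proper u _ _ (∈-neighbours⁻ v∈) (∈-neighbours⁻ w∈))
    (Unique.filter⁺ (λ w → T? (adj G u w)) (Unique.allFin⁺ (n G)))

  length-spectrum : ∀ (α : EdgeMap G) u → length (spectrum G α u) ≡ degree G u
  length-spectrum α u = length-map (α u) (neighbours G u)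

  spectrum-∘ : ∀ (f : ℕ → ℕ) (α : EdgeMap G) u → spectrum G (λ v w → f (α v w)) u ≡ map f (spectrum G α u)
  spectrum-∘ f α u = map-∘ (neighbours G u)

  ∈-spectrumSet⁺ : ∀ (α : EdgeMap G) D {u c} → T (D u) → c ∈ spectrum G α u → c ∈ spectrumSet G α D
  ∈-spectrumSet⁺ α D {u} u∈D c∈ = ∈-concatMap⁺ (spectrum G α) (lose (∈-filter⁺ (λ v → T? (D v)) (∈-allFin u) u∈D) c∈)

  ∈-spectrumSet⁻ : ∀ (α : EdgeMap G) D {c} → c ∈ spectrumSet G α D → ∃ λ u → T (D u) × c ∈ spectrum G α u
  ∈-spectrumSet⁻ α D c∈ with find (∈-concatMap⁻ (spectrum G α) {xs = filter (λ v → T? (D v)) (allFin (n G))} c∈)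
  ... | u , u∈ , c∈u = u , proj₂ (∈-filter⁻ (λ v → T? (D v)) {xs = allFin (n G)} u∈) , c∈u

  D-vertex-of-positive-degree : ∀ (α : EdgeMap G) D → ¬ spectrumSet G α D ≡ [] →
    ∃ λ u → T (D u) × 0 < degree G u
  D-vertex-of-positive-degree α D S≢[] with ∈-spectrumSet⁻ α D (proj₂ (≢[]⇒∃∈ S≢[]))
  ... | u , u∈D , c∈u = u , u∈D , subst (0 <_) (length-spectrum α u) (∈-length c∈u)

module Recolouring
  (G : Graph) (p : ℕ) (regular : ∀ v → degree G v ≡ suc p)
  (t₀ : ℕ) (α₀ : EdgeMap G) (α₀-proper : ProperEdgeColoring G t₀ α₀)
  (D : Vertex G → Bool) (u₀ : Vertex G) (u₀∈D : T (D u₀))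
  (outside-D : ∀ v → D v ≡ false → defV G α₀ v ≡ 0)
  (t : ℕ) (span≤t : suc (maxL (spectrumSet G α₀ D)) ∸ minL (spectrumSet G α₀ D) ≤ t) (t≤t₀ : t ≤ t₀)
  where

  open Spectra G
  open ProperEdgeColoring α₀-proper

  a b : ℕ
  a = minL (spectrumSet G α₀ D)
  b = maxL (spectrumSet G α₀ D)

  colour-range : ∀ {u c} → c ∈ spectrum G α₀ u → 1 ≤ c × c ≤ t₀
  colour-range {u} c∈ with ∈-spectrum⁻ α₀ c∈
  ... | v , uv , refl = range u v uv

  D-colour-range : ∀ {u c} → T (D u) → c ∈ spectrum G α₀ u → a ≤ c × c ≤ b
  D-colour-range u∈D c∈ = minL-≤ (∈-spectrumSet⁺ α₀ D u∈D c∈) , maxL-≤ (∈-spectrumSet⁺ α₀ D u∈D c∈)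

  1+b≤a+t : suc b ≤ a + t
  1+b≤a+t = ≤-trans (m≤n+m∸n (suc b) a) (+-monoʳ-≤ a span≤t)

  -- The r distinct colours at u₀ lie in [a, b].
  r≤t : suc p ≤ t
  r≤t = begin
    suc p                   ≡⟨ trans (length-spectrum α₀ u₀) (regular u₀) ⟨
    length (spectrum G α₀ u₀) ≤⟨ Unique∧InWindow⇒length≤ (suc b ∸ a) a (Unique-spectrum α₀-proper u₀)
                                   (All.tabulate (λ c∈ → in-[a,b] (D-colour-range u₀∈D c∈))) ⟩
    suc b ∸ a               ≤⟨ span≤t ⟩
    t                       ∎
    where
    open ≤-Reasoning
    in-[a,b] : ∀ {c} → a ≤ c × c ≤ b → InWindow (suc b ∸ a) a c
    in-[a,b] (a≤c , c≤b) = a≤c , ≤-trans (s≤s c≤b) (m≤n+m∸n (suc b) a)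

  -- Colours s + 1, …, s + t become 1, …, t; this window contains [a, b] and lies in [1, t₀].
  s : ℕ
  s = b ∸ t

  open Recolour p s t r≤t

  D-colour-InWindow : ∀ {u c} → T (D u) → c ∈ spectrum G α₀ u → InWindow t (suc s) c
  D-colour-InWindow u∈D c∈ with D-colour-range u∈D c∈
  ... | a≤c , c≤b = s<c , s≤s (≤-trans c≤b (subst (b ≤_) (+-comm t s) (m≤n+m∸n b t)))
    where
    s<c : s < _
    s<c = m<n+o⇒m∸n<o b t {{>-nonZero (proj₁ (colour-range c∈))}}
            (subst (b <_) (+-comm _ t) (≤-trans 1+b≤a+t (+-monoˡ-≤ t a≤c)))

  s+t≤t₀ : s + t ≤ t₀
  s+t≤t₀ with ≤-total t b
  ... | inj₁ t≤b = subst (_≤ t₀) (sym (m∸n+n≡m t≤b)) b≤t₀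
    where
    b≤t₀ : b ≤ t₀
    b≤t₀ = maxL-least (All.tabulate λ c∈ → let (_ , _ , c∈u) = ∈-spectrumSet⁻ α₀ D c∈ in proj₂ (colour-range c∈u))
  ... | inj₂ b≤t = subst (λ z → z + t ≤ t₀) (sym (m≤n⇒m∸n≡0 b≤t)) t≤t₀

  α : EdgeMap G
  α u v = recolour (α₀ u v) ∸ s

  spectrum-InWindow-outside-D : ∀ {u} → D u ≡ false → All (InWindow r (minL (spectrum G α₀ u))) (spectrum G α₀ u)
  spectrum-InWindow-outside-D {u} u∉D = subst (λ k → All (InWindow k (minL (spectrum G α₀ u))) (spectrum G α₀ u))
    (trans (length-spectrum α₀ u) (regular u))
    (defect≡0⇒InWindow (Unique-spectrum α₀-proper u) (outside-D u u∉D))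

  recolour-injective-on-spectrum : ∀ u {c c′} → c ∈ spectrum G α₀ u → c′ ∈ spectrum G α₀ u →
    recolour c ≡ recolour c′ → c ≡ c′
  recolour-injective-on-spectrum u c∈ c′∈ eq with T-or-false (D u)
  ... | inj₁ u∈D = trans (sym (recolour-middle (D-colour-InWindow u∈D c∈)))
                         (trans eq (recolour-middle (D-colour-InWindow u∈D c′∈)))
  ... | inj₂ u∉D with recolour-window (minL (spectrum G α₀ u))
  ... | L , _ , agrees = wrap-injective L c-in c′-in (trans (sym (agrees c-in)) (trans eq (agrees c′-in)))
    where
    c-in = All.lookup (spectrum-InWindow-outside-D u∉D) c∈
    c′-in = All.lookup (spectrum-InWindow-outside-D u∉D) c′∈

  s<recolour : ∀ c → s < recolour c
  s<recolour c = proj₁ (recolour-InWindow c)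

  α-proper : ProperEdgeColoring G t α
  α-proper = record
    { symm   = λ u v uv → cong (λ c → recolour c ∸ s) (symm u v uv)
    ; range  = λ u v uv → m<n⇒0<n∸m (s<recolour (α₀ u v))
                         , m≤n+o⇒m∸n≤o _ s (s≤s⁻¹ (proj₂ (recolour-InWindow (α₀ u v))))
    ; proper = λ u v w uv uw v≢w αuv≡αuw → proper u v w uv uw v≢w
                 (recolour-injective-on-spectrum u (∈-spectrum⁺ α₀ uv) (∈-spectrum⁺ α₀ uw)
                   (∸-cancelʳ-≡ (<⇒≤ (s<recolour (α₀ u v))) (<⇒≤ (s<recolour (α₀ u w))) αuv≡αuw))
    ; surj   = surjective
    }
    where
    surjective : ∀ k → 1 ≤ k → k ≤ t → Σ (Vertex G) λ u → Σ (Vertex G) λ v → Adj G u v × α u v ≡ k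
    surjective k 1≤k k≤t with surj (s + k) (≤-trans 1≤k (m≤n+m k s)) (≤-trans (+-monoʳ-≤ s k≤t) s+t≤t₀)
    ... | u , v , uv , α₀uv≡s+k = u , v , uv , (begin
      recolour (α₀ u v) ∸ s ≡⟨ cong (λ c → recolour c ∸ s) α₀uv≡s+k ⟩
      recolour (s + k) ∸ s ≡⟨ cong (_∸ s) (recolour-middle s+k-in) ⟩
      s + k ∸ s           ≡⟨ m+n∸m≡n s k ⟩
      k                   ∎)
      where
      s+k-in : InWindow t (suc s) (s + k)
      s+k-in = subst (_≤ s + k) (+-comm s 1) (+-monoʳ-≤ s 1≤k) , s≤s (+-monoʳ-≤ s k≤t)
      open ≡-Reasoning

  α-spectrum : ∀ u → spectrum G α u ≡ map (λ c → recolour c ∸ s) (spectrum G α₀ u)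
  α-spectrum = spectrum-∘ (λ c → recolour c ∸ s) α₀

  α-defect : ∀ v → defV G α v ≡ defV G α₀ v
  α-defect v with T-or-false (D v)
  ... | inj₁ v∈D = begin
    defect (spectrum G α v)                   ≡⟨ cong defect (trans (α-spectrum v) (map-cong-local unshifted)) ⟩
    defect (map (_∸ s) (spectrum G α₀ v))     ≡⟨ defect-map-∸ s (Unique-spectrum α₀-proper v)
                                                   (All.tabulate λ c∈ → <⇒≤ (proj₁ (D-colour-InWindow v∈D c∈))) ⟩
    defect (spectrum G α₀ v)                  ∎
    where
    open ≡-Reasoning
    unshifted : All (λ c → recolour c ∸ s ≡ c ∸ s) (spectrum G α₀ v)
    unshifted = All.tabulate λ c∈ → cong (_∸ s) (recolour-middle (D-colour-InWindow v∈D c∈))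
  ... | inj₂ v∉D with recolour-window (minL (spectrum G α₀ v))
  ... | L , 1+s≤L , agrees = trans (InWindow⇒defect≡0 (Unique-spectrum α-proper v) in-window) (sym (outside-D v v∉D))
    where
    in-window : All (InWindow (length (spectrum G α v)) (L ∸ s)) (spectrum G α v)
    in-window rewrite length-spectrum α v | regular v | α-spectrum v =
      AllP.map⁺ (All.map (λ {c} c-in → subst (InWindow r (L ∸ s)) (cong (_∸ s) (sym (agrees c-in)))
                                     (InWindow-∸ s (<⇒≤ 1+s≤L) (wrap-InWindow L c)))
                         (spectrum-InWindow-outside-D v∉D))

theorem2p5 : (G : Graph) → Regular G → (t₀ : ℕ) → (α₀ : EdgeMap G) → ProperEdgeColoring G t₀ α₀ →
    (D : Vertex G → Bool) → ¬ (spectrumSet G α₀ D ≡ []) →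
    (∀ v → D v ≡ false → defV G α₀ v ≡ 0) →
    (t : ℕ) → suc (maxL (spectrumSet G α₀ D)) ∸ minL (spectrumSet G α₀ D) ≤ t → t ≤ t₀ →
    Σ (EdgeMap G) λ α → ProperEdgeColoring G t α × (∀ v → defV G α v ≡ defV G α₀ v)
theorem2p5 G (zero , regular) t₀ α₀ _ D S≢[] _ _ _ _
  with Spectra.D-vertex-of-positive-degree G α₀ D S≢[]
... | u , _ , 0<deg = ⊥-elim (<-irrefl refl (subst (0 <_) (regular u) 0<deg))
theorem2p5 G (suc p , regular) t₀ α₀ α₀-proper D S≢[] outside-D t span≤t t≤t₀
  with Spectra.D-vertex-of-positive-degree G α₀ D S≢[]
... | u₀ , u₀∈D , _ = α , α-proper , α-defect
  where open Recolouring G p regular t₀ α₀ α₀-proper D u₀ u₀∈D outside-D t span≤t t≤t₀
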